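{- Let $G$ be a finite vertex-color-avoiding connected graph on $n$ vertices whose vertices are colored with exactly $k\in\mathbb{Z}_+$ colors. Then $|E(G)|\ge n-1$ if $k\le 2$, and $|E(G)|\ge n$ if $k\ge 3$. These lower bounds are sharp: for all positive integers $k\le n$ there exists a vertex-color-avoiding connected graph on $n$ vertices colored with exactly $k$ colors with exactly $n-1$ edges (if $k\le 2$) or exactly $n$ edges (if $k\ge 3$).
   Context: Vertex colorings are arbitrary (not necessarily proper). Two vertices $u,v$ are vertex-$c$-avoiding connected (for a color $c$) if there is a $u$-$v$ path and either at least one of $u,v$ has color $c$ or some $u$-$v$ path contains no vertex of color $c$. A graph is vertex-color-avoiding connected if every two vertices are vertex-$c$-avoiding connected for every color $c$. -}

module Defs where

open import Data.Nat using (ℕ; zero; suc; _+_; _<_; _<ᵇ_)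
open import Data.Fin using (Fin; toℕ)
open import Data.Bool using (Bool; true; false; _∧_; if_then_else_)
open import Data.List using (List; map; allFin)
open import Data.Nat.ListAction using (sum)
open import Data.Product using (_×_)
open import Data.Sum using (_⊎_)
open import Data.Unit using (⊤)
open import Relation.Nullary using (¬_)
open import Relation.Binary.PropositionalEquality using (_≡_)
open import Function.Definitions using (Surjective)

record Graph (n : ℕ) : Set where
  field
    adj   : Fin n → Fin n → Bool
    sym   : ∀ u v → adj u v ≡ adj v u
    irref : ∀ u → adj u u ≡ false
open Graph public

edgeCount : ∀ {n} → Graph n → ℕ
edgeCount {n} G =
  sum (map (λ i → sum (map (λ j → if (toℕ i <ᵇ toℕ j) ∧ adj G i j then 1 else 0)
                           (allFin n)))
           (allFin n))

-- Reach G P u v : there is a u–v walk in G all of whose vertices satisfy P.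
-- (A walk exists iff a path exists, so this is u–v path existence in G[P].)
data Reach {n} (G : Graph n) (P : Fin n → Set) : Fin n → Fin n → Set where
  here  : ∀ {u} → P u → Reach G P u u
  there : ∀ {u w v} → P u → adj G u w ≡ true → Reach G P w v → Reach G P u v

VertexCAvoidingConnected : ∀ {n k} → Graph n → (Fin n → Fin k) → Fin k
                           → Fin n → Fin n → Set
VertexCAvoidingConnected G col c u v =
  Reach G (λ _ → ⊤) u v
  × (col u ≡ c ⊎ col v ≡ c ⊎ Reach G (λ x → ¬ (col x ≡ c)) u v)

VertexColorAvoidingConnected : ∀ {n k} → Graph n → (Fin n → Fin k) → Set
VertexColorAvoidingConnected {n} {k} G col =
  ∀ (c : Fin k) (u v : Fin n) → VertexCAvoidingConnected G col c u v

UsesExactly : ∀ {n k} → (Fin n → Fin k) → Set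
UsesExactly col = Surjective _≡_ _≡_ col

-- Choose a root r and a breadth-first spanning tree T. Every vertex other than r owns the
-- edge to its parent, so |E(G)| = (n − 1) + #(edges outside T), whence |E(G)| ≥ n − 1.
-- Suppose k ≥ 3 and every edge lies in T. Some tree edge x – parent(x) is bichromatic; pick
-- w with a third colour. If w is in the subtree of x, a walk from w to parent(x) avoiding
-- col(x) has to leave that subtree, which it can only do along the edge x – parent(x), i.e.
-- through x. Otherwise a walk from w to x avoiding col(parent x) has to enter it through
-- parent(x). Both are absurd.
-- The bounds are attained by a path 0 – 1 – ⋯ – (k−1) with vertex i coloured i, the remaining
-- vertices pendant at 0 with colour 0, and, if k ≥ 3, the chord {0, k−1} closing a cycle.
module Submission where

open import Defs hiding (sym)
open import Data.Bool using (true; false; _∧_; if_then_else_)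
import Data.Bool.Properties as Bool
open import Data.Empty using (⊥; ⊥-elim)
open import Data.Fin as Fin using (Fin; toℕ; punchIn) renaming (zero to fzero; suc to fsuc)
open import Data.Fin.Properties
  using (_≟_; any?; <-cmp; toℕ<n; toℕ-injective; toℕ-inject₁; toℕ-inject≤; toℕ-fromℕ<; punchInᵢ≢i)
open import Data.List using (map; allFin; tabulate)
open import Data.List.Properties using (map-tabulate)
open import Data.Nat using (ℕ; zero; suc; pred; _+_; _∸_; _≤_; _<_; _≥_; _<ᵇ_; z≤n; s≤s; s≤s⁻¹)
import Data.Nat.ListAction as List
import Data.Nat.Properties as ℕ
open import Data.Nat.Properties using (_<?_; _≤?_; module ≤-Reasoning)
open import Algebra.Properties.CommutativeMonoid.Sum ℕ.+-0-commutativeMonoid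
  using (sum; sum-remove; ∑-distrib-+; ∑-comm; sum-cong-≗; sum-replicate-zero)
open import Data.Product using (_×_; Σ; ∃-syntax; _,_; proj₁; proj₂)
open import Data.Sum as Sum using (_⊎_; inj₁; inj₂; [_,_]′)
open import Data.Unit using (⊤)
open import Function using (_∘_; id)
open import Function.Bundles using (_⇔_; mk⇔)
open import Relation.Binary using (Decidable; tri<; tri≈; tri>)
open import Relation.Binary.PropositionalEquality
open import Relation.Nullary using (¬_; Dec; yes; no; does)
open import Relation.Nullary.Decidable
  using (¬?; _×-dec_; _⊎-dec_; dec-true; dec-false; does-⇔; decidable-stable)
import Relation.Unary as U

-- Counting pairs

𝟙 : ∀ {P : Set} → Dec P → ℕ
𝟙 P? = if does P? then 1 else 0

𝟙-yes : ∀ {P : Set} → P → (P? : Dec P) → 𝟙 P? ≡ 1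
𝟙-yes p P? = cong (if_then 1 else 0) (dec-true P? p)

𝟙-no : ∀ {P : Set} → ¬ P → (P? : Dec P) → 𝟙 P? ≡ 0
𝟙-no ¬p P? = cong (if_then 1 else 0) (dec-false P? ¬p)

𝟙-⊎ : ∀ {P Q : Set} → (P → Q → ⊥) → (P? : Dec P) (Q? : Dec Q) → 𝟙 (P? ⊎-dec Q?) ≡ 𝟙 P? + 𝟙 Q?
𝟙-⊎ disjoint (yes p) (yes q) = ⊥-elim (disjoint p q)
𝟙-⊎ _        (yes _) (no _)  = refl
𝟙-⊎ _        (no _)  (yes _) = refl
𝟙-⊎ _        (no _)  (no _)  = refl

dec-true⁻¹ : ∀ {P : Set} (P? : Dec P) → does P? ≡ true → P
dec-true⁻¹ (yes p) _ = p

term≤sum : ∀ {n} (f : Fin n → ℕ) i → f i ≤ sum f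
term≤sum {suc n} f i = subst (f i ≤_) (sym (sum-remove f)) (ℕ.m≤m+n (f i) _)

sum-zero : ∀ {n} {f : Fin n → ℕ} → (∀ i → f i ≡ 0) → sum f ≡ 0
sum-zero {n} f≡0 = trans (sum-cong-≗ f≡0) (sum-replicate-zero n)

sum-one : ∀ {n} → sum {n} (λ _ → 1) ≡ n
sum-one {zero}  = refl
sum-one {suc n} = cong suc (sum-one {n})

sum-allFin : ∀ {n} (f : Fin n → ℕ) → List.sum (map f (allFin n)) ≡ sum f
sum-allFin {n} f = trans (cong List.sum (map-tabulate id f)) (sum-tabulate f)
  where
  sum-tabulate : ∀ {m} (g : Fin m → ℕ) → List.sum (tabulate g) ≡ sum g
  sum-tabulate {zero}  g = refl
  sum-tabulate {suc m} g = cong (g fzero +_) (sum-tabulate (g ∘ fsuc))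

count : ∀ {n} {P : Fin n → Set} → U.Decidable P → ℕ
count P? = sum λ i → 𝟙 (P? i)

count-≡ : ∀ {n} (a : Fin n) → count (_≟ a) ≡ 1
count-≡ {suc n} a = begin
  count (_≟ a)
    ≡⟨ sum-remove {i = a} (𝟙 ∘ (_≟ a)) ⟩
  𝟙 (a ≟ a) + sum (λ j → 𝟙 (punchIn a j ≟ a))
    ≡⟨ cong₂ _+_ (𝟙-yes refl (a ≟ a)) (sum-zero λ j → 𝟙-no (punchInᵢ≢i a j) (punchIn a j ≟ a)) ⟩
  1 ∎
  where open ≡-Reasoning

count-≢ : ∀ {n} (a : Fin n) → count (λ i → ¬? (i ≟ a)) ≡ n ∸ 1
count-≢ {suc n} a = begin
  count (λ i → ¬? (i ≟ a))
    ≡⟨ sum-remove {i = a} (λ i → 𝟙 (¬? (i ≟ a))) ⟩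
  𝟙 (¬? (a ≟ a)) + sum (λ j → 𝟙 (¬? (punchIn a j ≟ a)))
    ≡⟨ cong₂ _+_ (𝟙-no (λ a≢a → a≢a refl) (¬? (a ≟ a)))
                 (sum-cong-≗ λ j → 𝟙-yes (punchInᵢ≢i a j) (¬? (punchIn a j ≟ a))) ⟩
  sum {n} (λ _ → 1)
    ≡⟨ sum-one ⟩
  n ∎
  where open ≡-Reasoning

pairCount : ∀ {n} {R : Fin n → Fin n → Set} → Decidable R → ℕ
pairCount R? = sum λ i → sum λ j → 𝟙 (R? i j)

module _ {n : ℕ} {R S : Fin n → Fin n → Set} (R? : Decidable R) (S? : Decidable S) where

  pairCount-cong : (∀ {i j} → R i j ⇔ S i j) → pairCount R? ≡ pairCount S?
  pairCount-cong R⇔S = sum-cong-≗ λ i → sum-cong-≗ λ j →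
    cong (if_then 1 else 0) (does-⇔ R⇔S (R? i j) (S? i j))

  pairCount-⊎ : (∀ {i j} → R i j → S i j → ⊥) →
                pairCount (λ i j → R? i j ⊎-dec S? i j) ≡ pairCount R? + pairCount S?
  pairCount-⊎ disjoint = begin
    sum (λ i → sum λ j → 𝟙 (R? i j ⊎-dec S? i j))
      ≡⟨ sum-cong-≗ (λ i → sum-cong-≗ λ j → 𝟙-⊎ disjoint (R? i j) (S? i j)) ⟩
    sum (λ i → sum λ j → 𝟙 (R? i j) + 𝟙 (S? i j))
      ≡⟨ sum-cong-≗ (λ i → ∑-distrib-+ (𝟙 ∘ R? i) (𝟙 ∘ S? i)) ⟩
    sum (λ i → sum (𝟙 ∘ R? i) + sum (𝟙 ∘ S? i))
      ≡⟨ ∑-distrib-+ (λ i → sum (𝟙 ∘ R? i)) (λ i → sum (𝟙 ∘ S? i)) ⟩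
    pairCount R? + pairCount S? ∎
    where open ≡-Reasoning

module _ {n : ℕ} {R : Fin n → Fin n → Set} (R? : Decidable R) where

  pairCount-flip : pairCount (λ i j → R? j i) ≡ pairCount R?
  pairCount-flip = ∑-comm (λ i j → 𝟙 (R? j i))

  pairCount-empty : (∀ {i j} → ¬ R i j) → pairCount R? ≡ 0
  pairCount-empty ∅ = sum-zero λ i → sum-zero λ j → 𝟙-no ∅ (R? i j)

  pairCount≡0⇒empty : pairCount R? ≡ 0 → ∀ {a b} → ¬ R a b
  pairCount≡0⇒empty none {a} {b} r = ℕ.1+n≰n (begin
    1               ≡⟨ 𝟙-yes r (R? a b) ⟨
    𝟙 (R? a b)      ≤⟨ term≤sum (𝟙 ∘ R? a) b ⟩
    sum (𝟙 ∘ R? a)  ≤⟨ term≤sum (λ i → sum (𝟙 ∘ R? i)) a ⟩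
    pairCount R?    ≡⟨ none ⟩
    0               ∎)
    where open ≤-Reasoning

pairCount-graphOf : ∀ {n} {P : Fin n → Set} (P? : U.Decidable P) (f : Fin n → Fin n) →
                    pairCount (λ i j → P? i ×-dec (j ≟ f i)) ≡ count P?
pairCount-graphOf {n} P? f = sum-cong-≗ row
  where
  row : ∀ i → sum (λ j → 𝟙 (P? i ×-dec (j ≟ f i))) ≡ 𝟙 (P? i)
  row i with P? i
  ... | yes _ = count-≡ (f i)
  ... | no _  = sum-zero {n} λ _ → refl

pairCount-singleton : ∀ {n} {R : Fin n → Fin n → Set} (R? : Decidable R) {a b : Fin n} →
                      (∀ {i j} → R i j ⇔ (i ≡ a × j ≡ b)) → pairCount R? ≡ 1
pairCount-singleton R? {a} {b} R⇔ab = begin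
  pairCount R?                               ≡⟨ pairCount-cong R? (λ i j → (i ≟ a) ×-dec (j ≟ b)) R⇔ab ⟩
  pairCount (λ i j → (i ≟ a) ×-dec (j ≟ b))  ≡⟨ pairCount-graphOf (_≟ a) (λ _ → b) ⟩
  count (_≟ a)                               ≡⟨ count-≡ a ⟩
  1                                          ∎
  where open ≡-Reasoning

module _ {n : ℕ} {R : Fin n → Fin n → Set} (R? : Decidable R)
         (irreflexive : ∀ {i} → ¬ R i i) (asymmetric : ∀ {i j} → R i j → ¬ R j i) where

  private
    Below Above : Fin n → Fin n → Set
    Below i j = toℕ i < toℕ j × R i j
    Above i j = toℕ j < toℕ i × R i j

    below? : Decidable Below
    below? i j = (toℕ i <? toℕ j) ×-dec R? i j

    above? : Decidable Above
    above? i j = (toℕ j <? toℕ i) ×-dec R? i j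

  pairCount-symmetrise :
    pairCount (λ i j → (toℕ i <? toℕ j) ×-dec (R? i j ⊎-dec R? j i)) ≡ pairCount R?
  pairCount-symmetrise = begin
    pairCount (λ i j → (toℕ i <? toℕ j) ×-dec (R? i j ⊎-dec R? j i))
      ≡⟨ pairCount-cong (λ i j → (toℕ i <? toℕ j) ×-dec (R? i j ⊎-dec R? j i))
                        (λ i j → below? i j ⊎-dec above? j i) (mk⇔ distribute factor) ⟩
    pairCount (λ i j → below? i j ⊎-dec above? j i)
      ≡⟨ pairCount-⊎ below? (λ i j → above? j i) (λ (_ , r) (_ , r′) → asymmetric r r′) ⟩
    pairCount below? + pairCount (λ i j → above? j i)
      ≡⟨ cong (pairCount below? +_) (pairCount-flip above?) ⟩
    pairCount below? + pairCount above?
      ≡⟨ pairCount-⊎ below? above? (λ (i<j , _) (j<i , _) → ℕ.<-asym i<j j<i) ⟨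
    pairCount (λ i j → below? i j ⊎-dec above? i j)
      ≡⟨ pairCount-cong (λ i j → below? i j ⊎-dec above? i j) R? (mk⇔ [ proj₂ , proj₂ ]′ split) ⟩
    pairCount R? ∎
    where
    open ≡-Reasoning
    distribute : ∀ {i j} → toℕ i < toℕ j × (R i j ⊎ R j i) → Below i j ⊎ Above j i
    distribute (i<j , inj₁ r) = inj₁ (i<j , r)
    distribute (i<j , inj₂ r) = inj₂ (i<j , r)
    factor : ∀ {i j} → Below i j ⊎ Above j i → toℕ i < toℕ j × (R i j ⊎ R j i)
    factor (inj₁ (i<j , r)) = i<j , inj₁ r
    factor (inj₂ (i<j , r)) = i<j , inj₂ r
    split : ∀ {i j} → R i j → Below i j ⊎ Above i j
    split {i} {j} r with <-cmp i j
    ... | tri< i<j _ _  = inj₁ (i<j , r)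
    ... | tri≈ _ refl _ = ⊥-elim (irreflexive r)
    ... | tri> _ _ j<i  = inj₂ (j<i , r)

-- Edges and walks

Edge : ∀ {n} → Graph n → Fin n → Fin n → Set
Edge G i j = toℕ i < toℕ j × adj G i j ≡ true

edge? : ∀ {n} (G : Graph n) → Decidable (Edge G)
edge? G i j = (toℕ i <? toℕ j) ×-dec (adj G i j Bool.≟ true)

edgeCount≡pairCount : ∀ {n} (G : Graph n) → edgeCount G ≡ pairCount (edge? G)
edgeCount≡pairCount {n} G = begin
  edgeCount G
    ≡⟨ sum-allFin (λ i → List.sum (map (summand i) (allFin n))) ⟩
  sum (λ i → List.sum (map (summand i) (allFin n)))
    ≡⟨ sum-cong-≗ (λ i → sum-allFin (summand i)) ⟩
  sum (λ i → sum (summand i))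
    ≡⟨ sum-cong-≗ (λ i → sum-cong-≗ (summand≡𝟙 i)) ⟩
  pairCount (edge? G) ∎
  where
  open ≡-Reasoning
  summand : Fin n → Fin n → ℕ
  summand i j = if (toℕ i <ᵇ toℕ j) ∧ adj G i j then 1 else 0
  summand≡𝟙 : ∀ i j → summand i j ≡ 𝟙 (edge? G i j)
  summand≡𝟙 i j with adj G i j
  ... | true  = refl
  ... | false = refl

adj-sym : ∀ {n} (G : Graph n) {u v} → adj G u v ≡ true → adj G v u ≡ true
adj-sym G {u} {v} uv = trans (Graph.sym G v u) uv

adj-irrefl : ∀ {n} (G : Graph n) {u} → adj G u u ≢ true
adj-irrefl G {u} uu with trans (sym uu) (irref G u)
... | ()

module _ {n : ℕ} {G : Graph n} {P : Fin n → Set} where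

  source : ∀ {u v} → Reach G P u v → P u
  source (here pu)      = pu
  source (there pu _ _) = pu

  length : ∀ {u v} → Reach G P u v → ℕ
  length (here _)       = 0
  length (there _ _ wv) = suc (length wv)

  infixr 5 _++_
  _++_ : ∀ {u v w} → Reach G P u v → Reach G P v w → Reach G P u w
  here _        ++ vw = vw
  there pu a uv ++ vw = there pu a (uv ++ vw)

  edge : ∀ {u v} → adj G u v ≡ true → P u → P v → Reach G P u v
  edge a pu pv = there pu a (here pv)

  reverse : ∀ {u v} → Reach G P u v → Reach G P v u
  reverse (here pu)       = here pu
  reverse (there pu a wv) = reverse wv ++ edge (adj-sym G a) (source wv) pu

  bichromatic-edge : ∀ {k} (col : Fin n → Fin k) {u v} → Reach G P u v → col u ≢ col v →
                     ∃[ x ] ∃[ y ] (adj G x y ≡ true × col x ≢ col y)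
  bichromatic-edge col (here _) cu≢cv = ⊥-elim (cu≢cv refl)
  bichromatic-edge col (there {u} {w} _ a wv) cu≢cv with col u ≟ col w
  ... | yes cu≡cw = bichromatic-edge col wv (λ cw≡cv → cu≢cv (trans cu≡cw cw≡cv))
  ... | no  cu≢cw = u , w , a , cu≢cw

-- Spanning trees

minimal-witness : ∀ {P : ℕ → Set} → U.Decidable P → ∀ {b} → P b →
                  ∃[ m ] (P m × ∀ {m′} → P m′ → m ≤ m′)
minimal-witness {P} P? = search 0 (λ ())
  where
  search : ∀ k {b} → (∀ {m} → m < k → ¬ P m) → P (k + b) → ∃[ m ] (P m × ∀ {m′} → P m′ → m ≤ m′)
  search k {b} none-below pk+b with P? k
  ... | yes pk = k , pk , λ pm′ → ℕ.≮⇒≥ λ m′<k → none-below m′<k pm′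
  ... | no ¬pk with b
  ...   | zero   = ⊥-elim (¬pk (subst P (ℕ.+-identityʳ k) pk+b))
  ...   | suc b′ = search (suc k) (λ m<1+k → [ none-below , (λ { refl → ¬pk }) ]′ (ℕ.m<1+n⇒m<n∨m≡n m<1+k))
                                  (subst P (ℕ.+-suc k b′) pk+b)

record SpanningTree {n : ℕ} (G : Graph n) (r : Fin n) : Set where
  field
    parent       : Fin n → Fin n
    depth        : Fin n → ℕ
    adj-parent   : ∀ {v} → v ≢ r → adj G v (parent v) ≡ true
    depth-parent : ∀ {v} → v ≢ r → depth (parent v) < depth v

module BreadthFirstSearch {n : ℕ} (G : Graph n) (r : Fin n) where

  Within : ℕ → Fin n → Set
  Within zero    v = v ≡ r
  Within (suc m) v = Within m v ⊎ ∃[ u ] (Within m u × adj G u v ≡ true)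

  within? : ∀ m → U.Decidable (Within m)
  within? zero    v = v ≟ r
  within? (suc m) v = within? m v ⊎-dec any? λ u → within? m u ×-dec (adj G u v Bool.≟ true)

  within-walk : ∀ {P m u v} → Within m u → (uv : Reach G P u v) → Within (m + length uv) v
  within-walk {m = m} {v = v} within-u (here _) =
    subst (λ l → Within l v) (sym (ℕ.+-identityʳ m)) within-u
  within-walk {m = m} {v = v} within-u (there _ a wv) =
    subst (λ l → Within l v) (sym (ℕ.+-suc m (length wv))) (within-walk (inj₂ (_ , within-u , a)) wv)

  module _ (connected : ∀ v → Reach G (λ _ → ⊤) r v) where

    private
      closest : ∀ v → ∃[ m ] (Within m v × ∀ {m′} → Within m′ v → m ≤ m′)
      closest v = minimal-witness (λ m → within? m v) (within-walk {m = 0} refl (connected v))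

    distance : Fin n → ℕ
    distance v = proj₁ (closest v)

    within-distance : ∀ v → Within (distance v) v
    within-distance v = proj₁ (proj₂ (closest v))

    distance-minimal : ∀ {m v} → Within m v → distance v ≤ m
    distance-minimal {v = v} = proj₂ (proj₂ (closest v))

    closer-neighbour : ∀ {v} m → Within m v → (∀ {m′} → Within m′ v → m ≤ m′) → v ≢ r →
                       ∃[ u ] (adj G u v ≡ true × distance u < m)
    closer-neighbour zero    v≡r                       _       v≢r = ⊥-elim (v≢r v≡r)
    closer-neighbour (suc m) (inj₁ within-v)           minimal _   = ⊥-elim (ℕ.1+n≰n (minimal within-v))
    closer-neighbour (suc m) (inj₂ (u , within-u , a)) _       _   = u , a , s≤s (distance-minimal within-u)

    parent-choice : ∀ v → Dec (v ≡ r) → ∃[ u ] (v ≢ r → adj G v u ≡ true × distance u < distance v)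
    parent-choice v (yes v≡r) = r , λ v≢r → ⊥-elim (v≢r v≡r)
    parent-choice v (no v≢r) with closer-neighbour (distance v) (within-distance v) distance-minimal v≢r
    ... | u , a , closer = u , λ _ → adj-sym G a , closer

    bfsTree : SpanningTree G r
    bfsTree = record
      { parent       = λ v → proj₁ (parent-choice v (v ≟ r))
      ; depth        = distance
      ; adj-parent   = λ {v} v≢r → proj₁ (proj₂ (parent-choice v (v ≟ r)) v≢r)
      ; depth-parent = λ {v} v≢r → proj₂ (proj₂ (parent-choice v (v ≟ r)) v≢r)
      }

module _ {n : ℕ} {G : Graph n} {r : Fin n} (T : SpanningTree G r) where
  open SpanningTree T

  ParentEdge : Fin n → Fin n → Set
  ParentEdge v u = v ≢ r × u ≡ parent v

  parentEdge? : Decidable ParentEdge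
  parentEdge? v u = ¬? (v ≟ r) ×-dec (u ≟ parent v)

  TreeEdge : Fin n → Fin n → Set
  TreeEdge u v = ParentEdge u v ⊎ ParentEdge v u

  treeEdge? : Decidable TreeEdge
  treeEdge? u v = parentEdge? u v ⊎-dec parentEdge? v u

  NonTreeEdge : Fin n → Fin n → Set
  NonTreeEdge u v = Edge G u v × ¬ TreeEdge u v

  nonTreeEdge? : Decidable NonTreeEdge
  nonTreeEdge? u v = edge? G u v ×-dec ¬? (treeEdge? u v)

  parentEdge-depth : ∀ {v u} → ParentEdge v u → depth u < depth v
  parentEdge-depth (v≢r , refl) = depth-parent v≢r

  parentEdge-adj : ∀ {v u} → ParentEdge v u → adj G v u ≡ true
  parentEdge-adj (v≢r , refl) = adj-parent v≢r

  treeEdge-adj : ∀ {u v} → TreeEdge u v → adj G u v ≡ true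
  treeEdge-adj (inj₁ uv) = parentEdge-adj uv
  treeEdge-adj (inj₂ vu) = adj-sym G (parentEdge-adj vu)

  edgeCount-spanningTree : edgeCount G ≡ n ∸ 1 + pairCount nonTreeEdge?
  edgeCount-spanningTree = begin
    edgeCount G
      ≡⟨ edgeCount≡pairCount G ⟩
    pairCount (edge? G)
      ≡⟨ pairCount-cong (edge? G) (λ i j → orderedTreeEdge? i j ⊎-dec nonTreeEdge? i j) (mk⇔ split merge) ⟩
    pairCount (λ i j → orderedTreeEdge? i j ⊎-dec nonTreeEdge? i j)
      ≡⟨ pairCount-⊎ orderedTreeEdge? nonTreeEdge? (λ (_ , tree) (_ , ¬tree) → ¬tree tree) ⟩
    pairCount orderedTreeEdge? + N
      ≡⟨ cong (_+ N) (pairCount-symmetrise parentEdge? parentEdge-irrefl parentEdge-asym) ⟩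
    pairCount parentEdge? + N
      ≡⟨ cong (_+ N) (pairCount-graphOf (λ v → ¬? (v ≟ r)) parent) ⟩
    count (λ v → ¬? (v ≟ r)) + N
      ≡⟨ cong (_+ N) (count-≢ r) ⟩
    n ∸ 1 + N ∎
    where
    open ≡-Reasoning
    N : ℕ
    N = pairCount nonTreeEdge?
    orderedTreeEdge? : Decidable λ u v → toℕ u < toℕ v × TreeEdge u v
    orderedTreeEdge? u v = (toℕ u <? toℕ v) ×-dec treeEdge? u v
    parentEdge-irrefl : ∀ {v} → ¬ ParentEdge v v
    parentEdge-irrefl vv = ℕ.<-irrefl refl (parentEdge-depth vv)
    parentEdge-asym : ∀ {u v} → ParentEdge u v → ¬ ParentEdge v u
    parentEdge-asym uv vu = ℕ.<-asym (parentEdge-depth uv) (parentEdge-depth vu)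
    split : ∀ {u v} → Edge G u v → (toℕ u < toℕ v × TreeEdge u v) ⊎ NonTreeEdge u v
    split {u} {v} (u<v , a) with treeEdge? u v
    ... | yes tree = inj₁ (u<v , tree)
    ... | no ¬tree = inj₂ ((u<v , a) , ¬tree)
    merge : ∀ {u v} → (toℕ u < toℕ v × TreeEdge u v) ⊎ NonTreeEdge u v → Edge G u v
    merge (inj₁ (u<v , tree)) = u<v , treeEdge-adj tree
    merge (inj₂ (e , _))      = e

  nonTreeEdges≡0⇒tree : pairCount nonTreeEdge? ≡ 0 → ∀ {u v} → adj G u v ≡ true → TreeEdge u v
  nonTreeEdges≡0⇒tree none {u} {v} a with treeEdge? u v | <-cmp u v
  ... | yes tree | _             = tree
  ... | no ¬tree | tri< u<v _ _  = ⊥-elim (pairCount≡0⇒empty nonTreeEdge? none ((u<v , a) , ¬tree))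
  ... | no ¬tree | tri≈ _ refl _ = ⊥-elim (adj-irrefl G a)
  ... | no ¬tree | tri> _ _ v<u  =
    ⊥-elim (pairCount≡0⇒empty nonTreeEdge? none ((v<u , adj-sym G a) , ¬tree ∘ Sum.swap))

-- Trees whose colouring is avoiding-connected

avoid-two : ∀ {k} (a b : Fin (3 + k)) → ∃[ c ] (c ≢ a × c ≢ b)
avoid-two fzero                fzero                = fsuc fzero        , (λ ()) , (λ ())
avoid-two fzero                (fsuc fzero)         = fsuc (fsuc fzero) , (λ ()) , (λ ())
avoid-two fzero                (fsuc (fsuc _))      = fsuc fzero        , (λ ()) , (λ ())
avoid-two (fsuc fzero)         fzero                = fsuc (fsuc fzero) , (λ ()) , (λ ())
avoid-two (fsuc fzero)         (fsuc fzero)         = fzero             , (λ ()) , (λ ())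
avoid-two (fsuc fzero)         (fsuc (fsuc _))      = fzero             , (λ ()) , (λ ())
avoid-two (fsuc (fsuc _))      fzero                = fsuc fzero        , (λ ()) , (λ ())
avoid-two (fsuc (fsuc _))      (fsuc fzero)         = fzero             , (λ ()) , (λ ())
avoid-two (fsuc (fsuc _))      (fsuc (fsuc _))      = fzero             , (λ ()) , (λ ())

module _ {n : ℕ} {G : Graph n} {r : Fin n} (T : SpanningTree G r) where
  open SpanningTree T

  data Subtree (x : Fin n) : Fin n → Set where
    root  : Subtree x x
    child : ∀ {z} → z ≢ r → Subtree x (parent z) → Subtree x z

  subtree-depth : ∀ {x z} → Subtree x z → depth x ≤ depth z
  subtree-depth root             = ℕ.≤-refl
  subtree-depth (child z≢r x≼pz) = ℕ.≤-trans (subtree-depth x≼pz) (ℕ.<⇒≤ (depth-parent z≢r))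

  parent∉subtree : ∀ {x} → x ≢ r → ¬ Subtree x (parent x)
  parent∉subtree x≢r x≼px = ℕ.<⇒≱ (depth-parent x≢r) (subtree-depth x≼px)

  subtree? : ∀ x z → Dec (Subtree x z)
  subtree? x z = search (suc (depth z)) z ℕ.≤-refl
    where
    search : ∀ fuel z → depth z < fuel → Dec (Subtree x z)
    search (suc fuel) z z<fuel with z ≟ x | z ≟ r
    ... | yes refl | _       = yes root
    ... | no z≢x   | yes z≡r = no λ { root → z≢x refl ; (child z≢r _) → z≢r z≡r }
    ... | no z≢x   | no z≢r with search fuel (parent z) (ℕ.<-≤-trans (depth-parent z≢r) (s≤s⁻¹ z<fuel))
    ...   | yes x≼pz = yes (child z≢r x≼pz)
    ...   | no x⋠pz  = no λ { root → z≢x refl ; (child _ x≼pz) → x⋠pz x≼pz }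

  module _ (tree : ∀ {u v} → adj G u v ≡ true → TreeEdge T u v) where

    leave-subtree : ∀ {P : Fin n → Set} {x u v} → Reach G P u v → Subtree x u → ¬ Subtree x v →
                    P x × P (parent x)
    leave-subtree (here _) x≼u x⋠v = ⊥-elim (x⋠v x≼u)
    leave-subtree {x = x} (there {w = w} pu a wv) x≼u x⋠v with subtree? x w
    ... | yes x≼w = leave-subtree wv x≼w x⋠v
    ... | no x⋠w with tree a | x≼u
    ...   | inj₁ (_ , refl)   | root         = pu , source wv
    ...   | inj₁ (_ , refl)   | child _ x≼pu = ⊥-elim (x⋠w x≼pu)
    ...   | inj₂ (w≢r , refl) | _            = ⊥-elim (x⋠w (child w≢r x≼u))

    enter-subtree : ∀ {P : Fin n → Set} {x u v} → Reach G P u v → ¬ Subtree x u → Subtree x v →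
                    P x × P (parent x)
    enter-subtree uv x⋠u x≼v = leave-subtree (reverse uv) x≼v x⋠u

    colourAvoiding⇒twoColours : ∀ {k} {col : Fin n → Fin k} → VertexColorAvoidingConnected G col →
      ∀ {x} → x ≢ r → col x ≢ col (parent x) → ∀ w → col w ≡ col x ⊎ col w ≡ col (parent x)
    colourAvoiding⇒twoColours {col = col} avoiding {x} x≢r cx≢cpx w
      with col w ≟ col x | col w ≟ col (parent x)
    ... | yes cw≡cx | _          = inj₁ cw≡cx
    ... | no _      | yes cw≡cpx = inj₂ cw≡cpx
    ... | no cw≢cx  | no cw≢cpx  = ⊥-elim (by-position (subtree? x w))
      where
      by-position : Dec (Subtree x w) → ⊥
      by-position (yes x≼w) with proj₂ (avoiding (col x) w (parent x))
      ... | inj₁ cw≡cx         = cw≢cx cw≡cx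
      ... | inj₂ (inj₁ cpx≡cx) = cx≢cpx (sym cpx≡cx)
      ... | inj₂ (inj₂ w→px)   = proj₁ (leave-subtree w→px x≼w (parent∉subtree x≢r)) refl
      by-position (no x⋠w) with proj₂ (avoiding (col (parent x)) w x)
      ... | inj₁ cw≡cpx        = cw≢cpx cw≡cpx
      ... | inj₂ (inj₁ cx≡cpx) = cx≢cpx cx≡cpx
      ... | inj₂ (inj₂ w→x)    = proj₂ (enter-subtree w→x x⋠w root) refl

    bichromatic-parentEdge : ∀ {k} (col : Fin n → Fin k) {x y} → adj G x y ≡ true → col x ≢ col y →
                             ∃[ z ] (z ≢ r × col z ≢ col (parent z))
    bichromatic-parentEdge col a cx≢cy with tree a
    ... | inj₁ (x≢r , refl) = _ , x≢r , cx≢cy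
    ... | inj₂ (y≢r , refl) = _ , y≢r , cx≢cy ∘ sym

    ≥3colours⇒¬colourAvoiding : ∀ {k} {col : Fin n → Fin (3 + k)} → UsesExactly col →
                                ¬ VertexColorAvoidingConnected G col
    ≥3colours⇒¬colourAvoiding {k} {col} onto avoiding = absurd
      where
      vertexOf : Fin (3 + k) → Fin n
      vertexOf c = proj₁ (onto c)
      coloured : ∀ c → col (vertexOf c) ≡ c
      coloured c = proj₂ (onto c) refl
      0≢1 : fzero {2 + k} ≢ fsuc fzero
      0≢1 ()
      bichromatic : ∃[ x ] ∃[ y ] (adj G x y ≡ true × col x ≢ col y)
      bichromatic = bichromatic-edge col (proj₁ (avoiding fzero (vertexOf fzero) (vertexOf (fsuc fzero))))
        λ c₀≡c₁ → 0≢1 (trans (sym (coloured fzero)) (trans c₀≡c₁ (coloured (fsuc fzero))))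
      absurd : ⊥
      absurd with bichromatic
      ... | x , y , a , cx≢cy with bichromatic-parentEdge col a cx≢cy
      ...   | z , z≢r , cz≢cpz with avoid-two (col z) (col (parent z))
      ...     | c , c≢cz , c≢cpz with colourAvoiding⇒twoColours avoiding z≢r cz≢cpz (vertexOf c)
      ...       | inj₁ c≡cz  = c≢cz (trans (sym (coloured c)) c≡cz)
      ...       | inj₂ c≡cpz = c≢cpz (trans (sym (coloured c)) c≡cpz)

edgeCount-lowerBound : ∀ n k → 1 ≤ k → (G : Graph n) (col : Fin n → Fin k) → UsesExactly col →
  VertexColorAvoidingConnected G col → (k ≤ 2 → edgeCount G ≥ n ∸ 1) × (k ≥ 3 → edgeCount G ≥ n)
edgeCount-lowerBound n (suc k) _ G col onto avoiding = (λ _ → ≥n∸1) , ≥n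
  where
  open ≤-Reasoning
  r : Fin n
  r = proj₁ (onto fzero)
  T : SpanningTree G r
  T = BreadthFirstSearch.bfsTree G r (λ v → proj₁ (avoiding fzero r v))
  N : ℕ
  N = pairCount (nonTreeEdge? T)
  ≥n∸1 : edgeCount G ≥ n ∸ 1
  ≥n∸1 = begin
    n ∸ 1        ≤⟨ ℕ.m≤m+n (n ∸ 1) N ⟩
    n ∸ 1 + N    ≡⟨ edgeCount-spanningTree T ⟨
    edgeCount G  ∎
  ≥n : suc k ≥ 3 → edgeCount G ≥ n
  ≥n (s≤s (s≤s (s≤s _))) with N ℕ.≟ 0
  ... | yes N≡0 = ⊥-elim (≥3colours⇒¬colourAvoiding T (nonTreeEdges≡0⇒tree T N≡0) onto avoiding)
  ... | no N≢0  = begin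
    n            ≡⟨ ℕ.m∸n+n≡m (ℕ.≤-<-trans z≤n (toℕ<n r)) ⟨
    n ∸ 1 + 1    ≤⟨ ℕ.+-monoʳ-≤ (n ∸ 1) (ℕ.n≢0⇒n>0 N≢0) ⟩
    n ∸ 1 + N    ≡⟨ edgeCount-spanningTree T ⟨
    edgeCount G  ∎

-- The extremal graphs

-- n′ and k′ stand for n − 1 and k − 1: vertices 0, …, k′ form the path.
module Construction (n′ k′ : ℕ) (k′≤n′ : k′ ≤ n′) where

  Vertex : Set
  Vertex = Fin (suc n′)

  OnPath : Vertex → Set
  OnPath v = toℕ v ≤ k′

  parent : Vertex → Vertex
  parent v with toℕ v ≤? k′
  ... | yes _ = Fin.pred v
  ... | no  _ = fzero

  toℕ-parent : ∀ {v} → OnPath v → toℕ (parent v) ≡ pred (toℕ v)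
  toℕ-parent {v} onPath with toℕ v ≤? k′
  ... | no off = ⊥-elim (off onPath)
  ... | yes _ with v
  ...   | fzero  = refl
  ...   | fsuc u = toℕ-inject₁ u

  parent-offPath : ∀ {v} → ¬ OnPath v → parent v ≡ fzero
  parent-offPath {v} off with toℕ v ≤? k′
  ... | yes onPath = ⊥-elim (off onPath)
  ... | no _       = refl

  parent-< : ∀ {v} → v ≢ fzero → toℕ (parent v) < toℕ v
  parent-< {fzero}  v≢0 = ⊥-elim (v≢0 refl)
  parent-< {fsuc u} _   = by-position (toℕ (fsuc u) ≤? k′)
    where
    by-position : Dec (OnPath (fsuc u)) → toℕ (parent (fsuc u)) < suc (toℕ u)
    by-position (yes onPath) = subst (_< suc (toℕ u)) (sym (toℕ-parent onPath)) ℕ.≤-refl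
    by-position (no off)     = subst (λ p → toℕ p < suc (toℕ u)) (sym (parent-offPath off)) (s≤s z≤n)

  ParentLink : Vertex → Vertex → Set
  ParentLink v u = v ≢ fzero × u ≡ parent v

  Chord : Vertex → Vertex → Set
  Chord u v = 2 ≤ k′ × u ≡ fzero × toℕ v ≡ k′

  Adjacent : Vertex → Vertex → Set
  Adjacent u v = (ParentLink u v ⊎ ParentLink v u) ⊎ (Chord u v ⊎ Chord v u)

  adjacent? : Decidable Adjacent
  adjacent? u v = (link? u v ⊎-dec link? v u) ⊎-dec (chord? u v ⊎-dec chord? v u)
    where
    link? : Decidable ParentLink
    link? v u = ¬? (v ≟ fzero) ×-dec (u ≟ parent v)
    chord? : Decidable Chord
    chord? u v = (2 ≤? k′) ×-dec (u ≟ fzero) ×-dec (toℕ v ℕ.≟ k′)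

  adjacent-sym : ∀ {u v} → Adjacent u v → Adjacent v u
  adjacent-sym = Sum.map Sum.swap Sum.swap

  adjacent-irrefl : ∀ {v} → ¬ Adjacent v v
  adjacent-irrefl (inj₁ (inj₁ (v≢0 , v≡pv))) = ℕ.<-irrefl (cong toℕ (sym v≡pv)) (parent-< v≢0)
  adjacent-irrefl (inj₁ (inj₂ (v≢0 , v≡pv))) = ℕ.<-irrefl (cong toℕ (sym v≡pv)) (parent-< v≢0)
  adjacent-irrefl (inj₂ (inj₁ (2≤k′ , refl , 0≡k′))) = ℕ.<⇒≢ (ℕ.≤-trans (s≤s z≤n) 2≤k′) 0≡k′
  adjacent-irrefl (inj₂ (inj₂ (2≤k′ , refl , 0≡k′))) = ℕ.<⇒≢ (ℕ.≤-trans (s≤s z≤n) 2≤k′) 0≡k′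

  graph : Graph (suc n′)
  graph = record
    { adj   = λ u v → does (adjacent? u v)
    ; sym   = λ u v → does-⇔ (mk⇔ adjacent-sym adjacent-sym) (adjacent? u v) (adjacent? v u)
    ; irref = λ v → dec-false (adjacent? v v) adjacent-irrefl
    }

  adjacent⇒adj : ∀ {u v} → Adjacent u v → adj graph u v ≡ true
  adjacent⇒adj {u} {v} = dec-true (adjacent? u v)

  adj⇒adjacent : ∀ {u v} → adj graph u v ≡ true → Adjacent u v
  adj⇒adjacent {u} {v} = dec-true⁻¹ (adjacent? u v)

  tree : SpanningTree graph fzero
  tree = record
    { parent       = parent
    ; depth        = toℕ
    ; adj-parent   = λ v≢0 → adjacent⇒adj (inj₁ (inj₁ (v≢0 , refl)))
    ; depth-parent = parent-<
    }

  lastVertex : Vertex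
  lastVertex = Fin.fromℕ< (s≤s k′≤n′)

  toℕ-last : toℕ lastVertex ≡ k′
  toℕ-last = toℕ-fromℕ< (s≤s k′≤n′)

  edgeCount-path : k′ ≤ 1 → edgeCount graph ≡ n′
  edgeCount-path k′≤1 = begin
    edgeCount graph                       ≡⟨ edgeCount-spanningTree tree ⟩
    n′ + pairCount (nonTreeEdge? tree)    ≡⟨ cong (n′ +_) (pairCount-empty (nonTreeEdge? tree) no-chord) ⟩
    n′ + 0                                ≡⟨ ℕ.+-identityʳ n′ ⟩
    n′                                    ∎
    where
    open ≡-Reasoning
    no-chord : ∀ {u v} → ¬ NonTreeEdge tree u v
    no-chord ((_ , a) , ¬tree) with adj⇒adjacent a
    ... | inj₁ link              = ¬tree link
    ... | inj₂ (inj₁ (2≤k′ , _)) = ℕ.<⇒≱ 2≤k′ k′≤1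
    ... | inj₂ (inj₂ (2≤k′ , _)) = ℕ.<⇒≱ 2≤k′ k′≤1

  edgeCount-cycle : 2 ≤ k′ → edgeCount graph ≡ suc n′
  edgeCount-cycle 2≤k′ = begin
    edgeCount graph                       ≡⟨ edgeCount-spanningTree tree ⟩
    n′ + pairCount (nonTreeEdge? tree)    ≡⟨ cong (n′ +_) (pairCount-singleton (nonTreeEdge? tree)
                                                                               (mk⇔ only-chord chord)) ⟩
    n′ + 1                                ≡⟨ ℕ.+-comm n′ 1 ⟩
    suc n′                                ∎
    where
    open ≡-Reasoning
    only-chord : ∀ {u v} → NonTreeEdge tree u v → u ≡ fzero × v ≡ lastVertex
    only-chord ((u<v , a) , ¬tree) with adj⇒adjacent a
    ... | inj₁ link                    = ⊥-elim (¬tree link)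
    ... | inj₂ (inj₁ (_ , u≡0 , v≡k′)) = u≡0 , toℕ-injective (trans v≡k′ (sym toℕ-last))
    ... | inj₂ (inj₂ (_ , refl , _))   = ⊥-elim (ℕ.n≮0 u<v)
    chord : ∀ {u v} → u ≡ fzero × v ≡ lastVertex → NonTreeEdge tree u v
    chord (refl , refl) = (0<last , adjacent⇒adj (inj₂ (inj₁ (2≤k′ , refl , toℕ-last)))) , not-link
      where
      0<last : 0 < toℕ lastVertex
      0<last = subst (0 <_) (sym toℕ-last) (ℕ.≤-trans (s≤s z≤n) 2≤k′)
      not-link : ¬ TreeEdge tree fzero lastVertex
      not-link (inj₁ (0≢0 , _))      = 0≢0 refl
      not-link (inj₂ (_ , 0≡parent)) = ℕ.<⇒≢ 0<parent (cong toℕ 0≡parent)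
        where
        0<parent : 0 < toℕ (parent lastVertex)
        0<parent = subst (0 <_) (sym (trans (toℕ-parent (ℕ.≤-reflexive toℕ-last)) (cong pred toℕ-last)))
                         (ℕ.pred-mono-≤ 2≤k′)

  pendant-adj : ∀ {v} → ¬ OnPath v → adj graph v fzero ≡ true
  pendant-adj {v} off = adjacent⇒adj (inj₁ (inj₁ (v≢0 , sym (parent-offPath off))))
    where
    v≢0 : v ≢ fzero
    v≢0 refl = off z≤n

  chord-adj : 2 ≤ k′ → adj graph lastVertex fzero ≡ true
  chord-adj 2≤k′ = adjacent⇒adj (inj₂ (inj₂ (2≤k′ , refl , toℕ-last)))

  along-path : ∀ {P : Vertex → Set} {u v} → toℕ v ≤ toℕ u → OnPath u →
               (∀ {x} → toℕ v ≤ toℕ x → toℕ x ≤ toℕ u → P x) → Reach graph P u v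
  along-path {P} {u} {v} v≤u onPath-u inside = descend (toℕ u ∸ toℕ v) u (sym (ℕ.m+[n∸m]≡n v≤u)) ℕ.≤-refl
    where
    descend : ∀ δ w → toℕ w ≡ toℕ v + δ → toℕ w ≤ toℕ u → Reach graph P w v
    descend zero w w≡v+0 _ =
      subst (λ x → Reach graph P x v) (toℕ-injective (sym (trans w≡v+0 (ℕ.+-identityʳ (toℕ v)))))
            (here (inside ℕ.≤-refl v≤u))
    descend (suc δ) w w≡v+1+δ w≤u =
      there (inside v≤w w≤u) (adjacent⇒adj (inj₁ (inj₁ (w≢0 , refl)))) (descend δ (parent w) pw≡v+δ pw≤u)
      where
      w≡1+v+δ : toℕ w ≡ suc (toℕ v + δ)
      w≡1+v+δ = trans w≡v+1+δ (ℕ.+-suc (toℕ v) δ)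
      v≤w : toℕ v ≤ toℕ w
      v≤w = subst (toℕ v ≤_) (sym w≡v+1+δ) (ℕ.m≤m+n (toℕ v) (suc δ))
      w≢0 : w ≢ fzero
      w≢0 refl = ℕ.0≢1+n w≡1+v+δ
      pw≡v+δ : toℕ (parent w) ≡ toℕ v + δ
      pw≡v+δ = trans (toℕ-parent (ℕ.≤-trans w≤u onPath-u)) (cong pred w≡1+v+δ)
      pw≤u : toℕ (parent w) ≤ toℕ u
      pw≤u = ℕ.<⇒≤ (ℕ.<-≤-trans (parent-< w≢0) w≤u)

  colour : Vertex → Fin (suc k′)
  colour v with toℕ v ≤? k′
  ... | yes onPath = Fin.fromℕ< (s≤s onPath)
  ... | no  _      = fzero

  toℕ-colour : ∀ {v} → OnPath v → toℕ (colour v) ≡ toℕ v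
  toℕ-colour {v} onPath with toℕ v ≤? k′
  ... | yes _  = toℕ-fromℕ< _
  ... | no off = ⊥-elim (off onPath)

  colour-offPath : ∀ {v} → ¬ OnPath v → colour v ≡ fzero
  colour-offPath {v} off with toℕ v ≤? k′
  ... | yes onPath = ⊥-elim (off onPath)
  ... | no _       = refl

  colour-onto : UsesExactly colour
  colour-onto c =
    Fin.inject≤ c (s≤s k′≤n′) , λ { refl → toℕ-injective (trans (toℕ-colour on) (toℕ-inject≤ c _)) }
    where
    on : OnPath (Fin.inject≤ c (s≤s k′≤n′))
    on = subst (_≤ k′) (sym (toℕ-inject≤ c _)) (s≤s⁻¹ (toℕ<n c))

  Avoiding : Fin (suc k′) → Vertex → Set
  Avoiding c x = ¬ colour x ≡ c

  avoiding-onPath : ∀ {c x} → OnPath x → toℕ x ≢ toℕ c → Avoiding c x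
  avoiding-onPath onPath x≢c cx≡c = x≢c (trans (sym (toℕ-colour onPath)) (cong toℕ cx≡c))

  coloured⇒onPath : ∀ {v} → colour v ≢ fzero → OnPath v
  coloured⇒onPath {v} cv≢0 = decidable-stable (toℕ v ≤? k′) (cv≢0 ∘ colour-offPath)

  to-root : ∀ u → Reach graph (λ _ → ⊤) u fzero
  to-root u with toℕ u ≤? k′
  ... | yes onPath = along-path z≤n onPath _
  ... | no off     = edge (pendant-adj off) _ _

  between-avoiding-0 : ∀ {u v} → toℕ v ≤ toℕ u → colour u ≢ fzero → colour v ≢ fzero →
                       Reach graph (Avoiding fzero) u v
  between-avoiding-0 {u} {v} v≤u cu≢0 cv≢0 = along-path v≤u (coloured⇒onPath cu≢0) inside
    where
    inside : ∀ {x} → toℕ v ≤ toℕ x → toℕ x ≤ toℕ u → Avoiding fzero x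
    inside {x} v≤x x≤u = avoiding-onPath (ℕ.≤-trans x≤u (coloured⇒onPath cu≢0)) x≢0
      where
      x≢0 : toℕ x ≢ 0
      x≢0 x≡0 = cv≢0 (cong colour (toℕ-injective (ℕ.n≤0⇒n≡0 (subst (toℕ v ≤_) x≡0 v≤x))))

  to-root-avoiding : ∀ {c u} → c ≢ fzero → colour u ≢ c → Reach graph (Avoiding c) u fzero
  to-root-avoiding {c} {u} c≢0 cu≢c = by-position (toℕ u ≤? k′)
    where
    0≢c : Avoiding c fzero
    0≢c = c≢0 ∘ sym
    by-position : Dec (OnPath u) → Reach graph (Avoiding c) u fzero
    by-position (no off) = edge (pendant-adj off) cu≢c 0≢c
    by-position (yes onPath) with ℕ.<-cmp (toℕ u) (toℕ c)
    ... | tri≈ _ u≡c _ = ⊥-elim (cu≢c (toℕ-injective (trans (toℕ-colour onPath) u≡c)))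
    ... | tri< u<c _ _ = along-path z≤n onPath λ _ x≤u →
                           avoiding-onPath (ℕ.≤-trans x≤u onPath) (ℕ.<⇒≢ (ℕ.≤-<-trans x≤u u<c))
    ... | tri> _ _ c<u =
      reverse (along-path u≤last last-onPath above-c) ++ edge (chord-adj 2≤k′) (above-c u≤last ℕ.≤-refl) 0≢c
      where
      u≤last : toℕ u ≤ toℕ lastVertex
      u≤last = subst (toℕ u ≤_) (sym toℕ-last) onPath
      last-onPath : OnPath lastVertex
      last-onPath = ℕ.≤-reflexive toℕ-last
      above-c : ∀ {x} → toℕ u ≤ toℕ x → toℕ x ≤ toℕ lastVertex → Avoiding c x
      above-c u≤x x≤last = avoiding-onPath (ℕ.≤-trans x≤last last-onPath) (ℕ.>⇒≢ (ℕ.<-≤-trans c<u u≤x))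
      2≤k′ : 2 ≤ k′
      2≤k′ = ℕ.≤-trans (s≤s (ℕ.n≢0⇒n>0 (c≢0 ∘ toℕ-injective))) (ℕ.≤-trans c<u onPath)

  colour-avoiding : VertexColorAvoidingConnected graph colour
  colour-avoiding c u v = to-root u ++ reverse (to-root v) , avoiding
    where
    avoiding : colour u ≡ c ⊎ colour v ≡ c ⊎ Reach graph (Avoiding c) u v
    avoiding with colour u ≟ c | colour v ≟ c
    ... | yes cu≡c | _        = inj₁ cu≡c
    ... | no _     | yes cv≡c = inj₂ (inj₁ cv≡c)
    ... | no cu≢c  | no cv≢c with c ≟ fzero | ℕ.≤-total (toℕ v) (toℕ u)
    ...   | yes refl | inj₁ v≤u = inj₂ (inj₂ (between-avoiding-0 v≤u cu≢c cv≢c))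
    ...   | yes refl | inj₂ u≤v = inj₂ (inj₂ (reverse (between-avoiding-0 u≤v cv≢c cu≢c)))
    ...   | no c≢0   | _        =
      inj₂ (inj₂ (to-root-avoiding c≢0 cu≢c ++ reverse (to-root-avoiding c≢0 cv≢c)))

sharp-construction : (n k : ℕ) → 1 ≤ k → k ≤ n →
  Σ (Graph n) λ G → Σ (Fin n → Fin k) λ col →
    UsesExactly col × VertexColorAvoidingConnected G col
    × (k ≤ 2 → edgeCount G ≡ n ∸ 1) × (k ≥ 3 → edgeCount G ≡ n)
sharp-construction (suc n′) (suc k′) _ (s≤s k′≤n′) =
  graph , colour , colour-onto , colour-avoiding ,
  (λ k≤2 → edgeCount-path (s≤s⁻¹ k≤2)) , (λ k≥3 → edgeCount-cycle (s≤s⁻¹ k≥3))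
  where open Construction n′ k′ k′≤n′

theorem3p11 :
    ((n k : ℕ) → 1 ≤ k → (G : Graph n) → (col : Fin n → Fin k)
      → UsesExactly col → VertexColorAvoidingConnected G col
      → (k ≤ 2 → edgeCount G ≥ n ∸ 1) × (k ≥ 3 → edgeCount G ≥ n))
    ×
    ((n k : ℕ) → 1 ≤ k → k ≤ n →
      Σ (Graph n) λ G → Σ (Fin n → Fin k) λ col →
        UsesExactly col × VertexColorAvoidingConnected G col
        × (k ≤ 2 → edgeCount G ≡ n ∸ 1) × (k ≥ 3 → edgeCount G ≡ n))
theorem3p11 = edgeCount-lowerBound , sharp-construction
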